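{- Let $r\ge 3$ and let $T$ be a tree with leaf ordering $x_0,\dots,x_k$. Let $G$ be a $K_{2,r}$-free graph with minimum degree $\delta(G)>2k+r-3$, equipped with a proper edge coloring. Then for every $v_0\in V(G)$ there exist distinct vertices $v_1,\dots,v_k$ such that (1) $x_ix_j\in E(T)$ implies $v_iv_j\in E(G)$; (2) these $k$ edges $v_iv_j$ all receive distinct colors; (3) $v_i$ is adjacent to $v_0$ if and only if $x_i$ is adjacent to $x_0$.
   Context: A leaf ordering of a tree $T$ on vertices $x_0,\dots,x_k$ is an ordering such that for every $1\le i\le k$, $x_i$ has exactly one neighbor among $x_0,\dots,x_{i-1}$. $G$ is $K_{2,r}$-free if it has no subgraph isomorphic to $K_{2,r}$. A proper edge coloring assigns colors to edges so that edges sharing a vertex get different colors. -}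

module Defs where

open import Data.Nat using (ℕ; zero; suc; _<_)
open import Data.Bool using (Bool; true; false)
open import Data.Fin using (Fin; toℕ)
open import Data.List using (length; filterᵇ; allFin)
open import Data.Product using (Σ; _×_; ∃)
open import Relation.Binary.PropositionalEquality using (_≡_)
open import Relation.Nullary using (¬_)
open import Function.Definitions using (Injective)

record Graph (n : ℕ) : Set where
  field
    adj   : Fin n → Fin n → Bool
    sym   : ∀ u v → adj u v ≡ adj v u
    irrefl : ∀ v → adj v v ≡ false
open Graph public

_∼[_]_ : ∀ {n} → Fin n → Graph n → Fin n → Set
u ∼[ G ] v = adj G u v ≡ true

degree : ∀ {n} → Graph n → Fin n → ℕ
degree {n} G v = length (filterᵇ (adj G v) (allFin n))

minDegree> : ∀ {n} → Graph n → ℕ → Set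
minDegree> G d = ∀ v → d < degree G v

-- G contains K_{2,r} as a (not necessarily induced) subgraph:
-- two distinct vertices a, b and r distinct vertices each adjacent to both.
-- (The r vertices are automatically distinct from a, b by irreflexivity.)
HasK2r : ∀ {n} → Graph n → ℕ → Set
HasK2r {n} G r =
  Σ (Fin n) λ a → Σ (Fin n) λ b → ¬ (a ≡ b) ×
  Σ (Fin r → Fin n) λ w → Injective _≡_ _≡_ w ×
  (∀ i → (a ∼[ G ] w i) × (b ∼[ G ] w i))

K2r-free : ∀ {n} → Graph n → ℕ → Set
K2r-free G r = ¬ HasK2r G r

record ProperEdgeColouring {n} (G : Graph n) : Set where
  field
    col    : Fin n → Fin n → ℕ
    col-sym : ∀ u v → col u v ≡ col v u
    proper : ∀ u v w → u ∼[ G ] v → u ∼[ G ] w → ¬ (v ≡ w) → ¬ (col u v ≡ col u w)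
open ProperEdgeColouring public

-- The natural order 0,1,…,k of the vertex set Fin (suc k) of T is a leaf
-- ordering: every i ≥ 1 has exactly one neighbour j with j < i.
IsLeafOrdering : ∀ {k} → Graph (suc k) → Set
IsLeafOrdering {k} T =
  ∀ (i : Fin (suc k)) → 0 < toℕ i →
    Σ (Fin (suc k)) λ j → (toℕ j < toℕ i) × (i ∼[ T ] j) ×
      (∀ j' → toℕ j' < toℕ i → i ∼[ T ] j' → j' ≡ j)

module Submission where

-- Embed x₁, …, x_k greedily in the leaf order, i.e. by induction on k, deleting the last leaf.
-- When x_k is added, its parent x_p already has an image v_p, and v_k is sought among the
-- neighbours of v_p, of which there are more than 2k + r − 3. It has to avoid the k − 1 images
-- other than v_p, one neighbour for each of the k − 1 colours already used (the colouring is
-- proper), and, when x_p ≠ x₀, the common neighbours of v₀ and v_p, of which there are at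
-- most r − 1 because G is K_{2,r}-free; together at most 2k + r − 3 vertices.

open import Defs
open import Data.Nat using (ℕ; zero; suc; _+_; _*_; _∸_; _<_; _≤_; z≤n; s≤s; s≤s⁻¹; _≤?_)
open import Data.Nat.Properties
  using (≤-trans; ≤-reflexive; ≤-<-trans; <⇒≱; ≰⇒>; n≤1+n; +-monoʳ-≤; +-monoˡ-≤; *-monoʳ-≤; ∸-monoˡ-≤)
  renaming (_≟_ to _≟ℕ_)
open import Data.Nat.Tactic.RingSolver using (solve-∀)
open import Data.Bool using (Bool; true; false; not; _∧_) renaming (T to IsTrue)
open import Data.Bool.Properties using (T-≡; T-∧; ¬-not)
open import Data.Fin using (Fin; zero; suc; toℕ; fromℕ; inject₁; inject≤)
open import Data.Fin.Properties
  using (_≟_; toℕ-fromℕ; toℕ-inject₁; toℕ≤pred[n]; inject₁-injective; inject₁ℕ<; inject≤-injective)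
open import Data.Fin.Relation.Unary.Top using (view; ‵fromℕ; ‵inject₁)
open import Data.List using (List; []; _∷_; length; filterᵇ; allFin; tabulate; lookup; map; _++_)
open import Data.List.Properties using (filter-all; length-++; length-tabulate; length-map)
open import Data.List.Membership.Propositional using (_∈_)
open import Data.List.Membership.Propositional.Properties using (∈-filter⁺; ∈-filter⁻; ∈-allFin; ∈-lookup)
open import Data.List.Relation.Unary.All as All using (All; []; _∷_)
import Data.List.Relation.Unary.All.Properties as All
open import Data.List.Relation.Unary.Any using (here; there)
open import Data.List.Relation.Unary.AllPairs using (_∷_)
open import Data.List.Relation.Unary.Unique.Propositional using (Unique)
import Data.List.Relation.Unary.Unique.Propositional.Properties as Unique
open import Data.Product using (Σ; _×_; _,_; proj₁; proj₂; ∃-syntax)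
open import Data.Empty using (⊥-elim)
open import Function using (_∘_; Equivalence)
open import Function.Definitions using (Injective)
open import Relation.Binary.PropositionalEquality
  using (_≡_; _≢_; refl; trans; cong; cong₂; subst; subst₂; module ≡-Reasoning)
  renaming (sym to ≡-sym)
open import Relation.Nullary using (¬_; yes; no)
open import Relation.Nullary.Decidable using (T?; ⌊_⌋; toWitness; fromWitness; decidable-stable)

open Equivalence using (to; from)

module _ {A : Set} where

  AtMostOne : (A → Bool) → Set
  AtMostOne P = ∀ {x y} → IsTrue (P x) → IsTrue (P y) → x ≡ y

  Avoids : A → List (A → Bool) → Set
  Avoids x Ps = All (λ P → ¬ IsTrue (P x)) Ps

  lookup-injective : ∀ {L : List A} → Unique L → ∀ i j → lookup L i ≡ lookup L j → i ≡ j
  lookup-injective (_ ∷ _) zero zero _ = refl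
  lookup-injective (x∉L ∷ _) zero (suc j) eq = ⊥-elim (All.lookup x∉L (∈-lookup j) eq)
  lookup-injective (x∉L ∷ _) (suc i) zero eq = ⊥-elim (All.lookup x∉L (∈-lookup i) (≡-sym eq))
  lookup-injective (_ ∷ u) (suc i) (suc j) eq = cong suc (lookup-injective u i j eq)

  Unique⇒injection : ∀ {r} {L : List A} → Unique L → r ≤ length L →
                     Σ (Fin r → A) λ w → Injective _≡_ _≡_ w × (∀ i → w i ∈ L)
  Unique⇒injection {L = L} u r≤|L| =
    (λ i → lookup L (inject≤ i r≤|L|)) ,
    (λ {i} {j} eq → inject≤-injective r≤|L| r≤|L| i j (lookup-injective u _ _ eq)) ,
    (λ i → ∈-lookup (inject≤ i r≤|L|))

  length≤suc-reject : (P : A → Bool) → AtMostOne P → ∀ {L} → Unique L →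
                      length L ≤ suc (length (filterᵇ (not ∘ P) L))
  length≤suc-reject P one {[]} _ = z≤n
  length≤suc-reject P one {x ∷ L} (x∉L ∷ u) with P x in Px
  ... | false = s≤s (length≤suc-reject P one u)
  ... | true  = s≤s (≤-reflexive (≡-sym (cong length (filter-all (T? ∘ not ∘ P) (All.tabulate rejected)))))
    where
    rejected : ∀ {y} → y ∈ L → IsTrue (not (P y))
    rejected {y} y∈L with P y in Py
    ... | false = _
    ... | true  = ⊥-elim (All.lookup x∉L y∈L (one (from T-≡ Px) (from T-≡ Py)))

  pigeonhole-avoid : ∀ {L} → Unique L → (Ps : List (A → Bool)) → All AtMostOne Ps → length Ps < length L →
          ∃[ x ] x ∈ L × Avoids x Ps
  pigeonhole-avoid {x ∷ _} _ [] [] _ = x , here refl , []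
  pigeonhole-avoid {L} u (P ∷ Ps) (one ∷ ones) |P∷Ps|<|L|
    with x , x∈L′ , avoidsPs ← pigeonhole-avoid (Unique.filter⁺ (T? ∘ not ∘ P) u) Ps ones
           (s≤s⁻¹ (≤-trans |P∷Ps|<|L| (length≤suc-reject P one u)))
    with x∈L , ¬Px ← ∈-filter⁻ (T? ∘ not ∘ P) {xs = L} x∈L′
    = x , x∈L , IsTrue-not⇒¬IsTrue ¬Px ∷ avoidsPs
    where
    IsTrue-not⇒¬IsTrue : ∀ {b} → IsTrue (not b) → ¬ IsTrue b
    IsTrue-not⇒¬IsTrue {false} _ ()

_∷ʳ_ : ∀ {n} {A : Set} → (Fin n → A) → A → Fin (suc n) → A
_∷ʳ_ {zero}  f a _       = a
_∷ʳ_ {suc n} f a zero    = f zero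
_∷ʳ_ {suc n} f a (suc i) = ((f ∘ suc) ∷ʳ a) i

∷ʳ-last : ∀ {n} {A : Set} (f : Fin n → A) a → (f ∷ʳ a) (fromℕ n) ≡ a
∷ʳ-last {zero}  f a = refl
∷ʳ-last {suc n} f a = ∷ʳ-last (f ∘ suc) a

∷ʳ-inject₁ : ∀ {n} {A : Set} (f : Fin n → A) a i → (f ∷ʳ a) (inject₁ i) ≡ f i
∷ʳ-inject₁ {suc n} f a zero    = refl
∷ʳ-inject₁ {suc n} f a (suc i) = ∷ʳ-inject₁ (f ∘ suc) a i

inject₁-below : ∀ {n} {i j : Fin (suc n)} → toℕ j < toℕ i → Σ (Fin n) λ j′ → j ≡ inject₁ j′
inject₁-below {n} {i} {j} j<i with view j
... | ‵fromℕ      = ⊥-elim (<⇒≱ j<i (subst (toℕ i ≤_) (≡-sym (toℕ-fromℕ n)) (toℕ≤pred[n] i)))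
... | ‵inject₁ j′ = j′ , refl

constraints<candidates : ∀ {r k d e} → e < r → 2 * suc k + r ∸ 3 < d → suc k + (k + e) < suc d
constraints<candidates {suc r} {k} {d} {e} (s≤s e≤r) bound =
  s≤s (≤-<-trans (+-monoʳ-≤ k (+-monoʳ-≤ k e≤r)) (subst (_< d) (cong (_∸ 3) (double-suc k r)) bound))
  where
  double-suc : ∀ k r → 2 * suc k + suc r ≡ 3 + (k + (k + r))
  double-suc = solve-∀

is : ∀ {n} → Fin n → Fin n → Bool
is y x = ⌊ x ≟ y ⌋

is-atMostOne : ∀ {n} (y : Fin n) → AtMostOne (is y)
is-atMostOne y {x} {x′} x≡y x′≡y =
  trans (toWitness {a? = x ≟ y} x≡y) (≡-sym (toWitness {a? = x′ ≟ y} x′≡y))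

∼-irrefl : ∀ {n} (G : Graph n) {u} → ¬ u ∼[ G ] u
∼-irrefl G {u} u∼u with () ← trans (≡-sym u∼u) (irrefl G u)

module _ {n} (G : Graph n) where

  neighbours : Fin n → List (Fin n)
  neighbours u = filterᵇ (adj G u) (allFin n)

  ∈-neighbours⁺ : ∀ {u x} → u ∼[ G ] x → x ∈ neighbours u
  ∈-neighbours⁺ {u} {x} u∼x = ∈-filter⁺ (T? ∘ adj G u) (∈-allFin x) (from T-≡ u∼x)

  ∈-neighbours⁻ : ∀ {u x} → x ∈ neighbours u → u ∼[ G ] x
  ∈-neighbours⁻ {u} x∈ = to T-≡ (proj₂ (∈-filter⁻ (T? ∘ adj G u) {xs = allFin n} x∈))

  ∈-closedNeighbourhood⁻ : ∀ {u x} → x ∈ u ∷ neighbours u → x ≢ u → u ∼[ G ] x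
  ∈-closedNeighbourhood⁻ (here x≡u)  x≢u = ⊥-elim (x≢u x≡u)
  ∈-closedNeighbourhood⁻ (there x∈N) _   = ∈-neighbours⁻ x∈N

  neighbours-unique : ∀ u → Unique (neighbours u)
  neighbours-unique u = Unique.filter⁺ (T? ∘ adj G u) (Unique.allFin⁺ n)

  closedNeighbourhood-unique : ∀ u → Unique (u ∷ neighbours u)
  closedNeighbourhood-unique u =
    All.tabulate (λ x∈ u≡x → ∼-irrefl G (subst (u ∼[ G ]_) (≡-sym u≡x) (∈-neighbours⁻ x∈)))
    ∷ neighbours-unique u

  commonNeighbours : Fin n → Fin n → List (Fin n)
  commonNeighbours a b = filterᵇ (adj G a) (neighbours b)

  ∈-commonNeighbours⁺ : ∀ {a b x} → a ∼[ G ] x → b ∼[ G ] x → x ∈ commonNeighbours a b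
  ∈-commonNeighbours⁺ {a} a∼x b∼x = ∈-filter⁺ (T? ∘ adj G a) (∈-neighbours⁺ b∼x) (from T-≡ a∼x)

  ∈-commonNeighbours⁻ : ∀ {a b x} → x ∈ commonNeighbours a b → (a ∼[ G ] x) × (b ∼[ G ] x)
  ∈-commonNeighbours⁻ {a} {b} x∈ with x∈N[b] , a∼x ← ∈-filter⁻ (T? ∘ adj G a) {xs = neighbours b} x∈ =
    to T-≡ a∼x , ∈-neighbours⁻ x∈N[b]

  length-commonNeighbours< : ∀ {r a b} → K2r-free G r → a ≢ b → length (commonNeighbours a b) < r
  length-commonNeighbours< {r} {a} {b} noK2r a≢b with r ≤? length (commonNeighbours a b)
  ... | no r≰ = ≰⇒> r≰
  ... | yes r≤
    with w , w-injective , w∈ ← Unique⇒injection (Unique.filter⁺ (T? ∘ adj G a) (neighbours-unique b)) r≤ =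
    ⊥-elim (noK2r (a , b , a≢b , w , w-injective , ∈-commonNeighbours⁻ ∘ w∈))

module _ {n} {G : Graph n} (c : ProperEdgeColouring G) where

  hasColour : Fin n → ℕ → Fin n → Bool
  hasColour u γ x = adj G u x ∧ ⌊ col c u x ≟ℕ γ ⌋

  hasColour-atMostOne : ∀ u γ → AtMostOne (hasColour u γ)
  hasColour-atMostOne u γ {x} {y} x-γ y-γ
    with u∼x , ux≡γ ← to T-∧ x-γ | u∼y , uy≡γ ← to T-∧ y-γ =
    decidable-stable (x ≟ y) λ x≢y →
      proper c u x y (to T-≡ u∼x) (to T-≡ u∼y) x≢y (trans (toWitness ux≡γ) (≡-sym (toWitness uy≡γ)))

deleteLast : ∀ {n} → Graph (suc n) → Graph n
deleteLast T = record
  { adj    = λ i j → adj T (inject₁ i) (inject₁ j)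
  ; sym    = λ i j → sym T (inject₁ i) (inject₁ j)
  ; irrefl = λ i → irrefl T (inject₁ i)
  }

module _ {k} {T : Graph (suc k)} (lo : IsLeafOrdering T) where

  parent : Fin k → Fin (suc k)
  parent m = proj₁ (lo (suc m) (s≤s z≤n))

  downEdge⇒parent : ∀ {i j} → i ∼[ T ] j → toℕ j < toℕ i → Σ (Fin k) λ m → (i ≡ suc m) × (j ≡ parent m)
  downEdge⇒parent {suc m} {j} i∼j j<i = m , refl , proj₂ (proj₂ (proj₂ (lo (suc m) (s≤s z≤n)))) j j<i i∼j

module _ {k} {T : Graph (suc (suc k))} (lo : IsLeafOrdering T) where

  deleteLast-isLeafOrdering : IsLeafOrdering (deleteLast T)
  deleteLast-isLeafOrdering i 0<i
    with lo (inject₁ i) (subst (0 <_) (≡-sym (toℕ-inject₁ i)) 0<i)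
  ... | j , j<i , i∼j , j-unique with j′ , refl ← inject₁-below j<i =
    j′ , subst₂ _<_ (toℕ-inject₁ j′) (toℕ-inject₁ i) j<i , i∼j ,
    λ j″ j″<i i∼j″ → inject₁-injective (j-unique (inject₁ j″)
      (subst₂ _<_ (≡-sym (toℕ-inject₁ j″)) (≡-sym (toℕ-inject₁ i)) j″<i) i∼j″)

  lastLeaf : Σ (Fin (suc k)) λ p → (fromℕ (suc k) ∼[ T ] inject₁ p) ×
                                    (∀ j → fromℕ (suc k) ∼[ T ] inject₁ j → j ≡ p)
  lastLeaf with lo (fromℕ (suc k)) (s≤s z≤n)
  ... | j , j<last , last∼j , j-unique with p , refl ← inject₁-below j<last =
    p , last∼j ,
    λ j′ last∼j′ → inject₁-injective (j-unique (inject₁ j′)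
      (subst (toℕ (inject₁ j′) <_) (≡-sym (toℕ-fromℕ (suc k))) (inject₁ℕ< j′)) last∼j′)

record RainbowEmbedding {k n} (T : Graph (suc k)) (G : Graph n) (c : ProperEdgeColouring G) (v₀ : Fin n) : Set where
  field
    v           : Fin (suc k) → Fin n
    v-root      : v zero ≡ v₀
    v-injective : Injective _≡_ _≡_ v
    v-edge      : ∀ i j → i ∼[ T ] j → v i ∼[ G ] v j
    v-rainbow   : ∀ i j i′ j′ → i ∼[ T ] j → i′ ∼[ T ] j′ → toℕ j < toℕ i → toℕ j′ < toℕ i′ →
                  col c (v i) (v j) ≡ col c (v i′) (v j′) → (i ≡ i′) × (j ≡ j′)
    v-root-adj  : ∀ i → adj G (v i) v₀ ≡ adj T i zero

trivialEmbedding : ∀ {n} (T : Graph 1) {G : Graph n} (c : ProperEdgeColouring G) (v₀ : Fin n) →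
                   RainbowEmbedding T G c v₀
trivialEmbedding T {G} c v₀ = record
  { v           = λ _ → v₀
  ; v-root      = refl
  ; v-injective = λ { {zero} {zero} _ → refl }
  ; v-edge      = λ { zero zero 0∼0 → ⊥-elim (∼-irrefl T 0∼0) }
  ; v-rainbow   = λ { zero zero _ _ _ _ () }
  ; v-root-adj  = λ { zero → trans (irrefl G v₀) (≡-sym (irrefl T zero)) }
  }

module Extension {k n} {T : Graph (suc (suc k))} (lo : IsLeafOrdering T)
                 {G : Graph n} {c : ProperEdgeColouring G} {v₀ : Fin n}
                 (E : RainbowEmbedding (deleteLast T) G c v₀) where

  open RainbowEmbedding E

  lo′ : IsLeafOrdering (deleteLast T)
  lo′ = deleteLast-isLeafOrdering {T = T} lo

  last : Fin (suc (suc k))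
  last = fromℕ (suc k)

  p : Fin (suc k)
  p = proj₁ (lastLeaf {T = T} lo)

  last∼p : last ∼[ T ] inject₁ p
  last∼p = proj₁ (proj₂ (lastLeaf {T = T} lo))

  p-unique : ∀ j → last ∼[ T ] inject₁ j → j ≡ p
  p-unique = proj₂ (proj₂ (lastLeaf {T = T} lo))

  data DownEdge : Fin (suc (suc k)) → Fin (suc (suc k)) → Set where
    new : DownEdge last (inject₁ p)
    old : ∀ {i j} → i ∼[ deleteLast T ] j → toℕ j < toℕ i → DownEdge (inject₁ i) (inject₁ j)

  downEdge : ∀ {i j} → i ∼[ T ] j → toℕ j < toℕ i → DownEdge i j
  downEdge {i} i∼j j<i with j′ , refl ← inject₁-below j<i with view i
  ... | ‵fromℕ rewrite p-unique j′ i∼j = new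
  ... | ‵inject₁ i′ = old i∼j (subst₂ _<_ (toℕ-inject₁ j′) (toℕ-inject₁ i′) j<i)

  record Admissible (w : Fin n) : Set where
    field
      p∼w       : v p ∼[ G ] w
      fresh     : ∀ i → w ≢ v i
      newColour : ∀ i j → i ∼[ deleteLast T ] j → toℕ j < toℕ i → col c (v p) w ≢ col c (v i) (v j)

  module _ {w} (admissible : Admissible w) (w-root-adj : adj G w v₀ ≡ adj T last zero) where
    open Admissible admissible

    u : Fin (suc (suc k)) → Fin n
    u = v ∷ʳ w

    u-last : u last ≡ w
    u-last = ∷ʳ-last v w

    u-old : ∀ i → u (inject₁ i) ≡ v i
    u-old = ∷ʳ-inject₁ v w

    u-injective : Injective _≡_ _≡_ u
    u-injective {i} {j} ui≡uj with view i | view j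
    ... | ‵fromℕ      | ‵fromℕ      = refl
    ... | ‵fromℕ      | ‵inject₁ j′ =
      ⊥-elim (fresh j′ (trans (≡-sym u-last) (trans ui≡uj (u-old j′))))
    ... | ‵inject₁ i′ | ‵fromℕ      =
      ⊥-elim (fresh i′ (trans (≡-sym u-last) (trans (≡-sym ui≡uj) (u-old i′))))
    ... | ‵inject₁ i′ | ‵inject₁ j′ =
      cong inject₁ (v-injective (trans (≡-sym (u-old i′)) (trans ui≡uj (u-old j′))))

    u-newEdge : ∀ j → last ∼[ T ] inject₁ j → u last ∼[ G ] u (inject₁ j)
    u-newEdge j last∼j rewrite u-last | u-old j | p-unique j last∼j = trans (sym G w (v p)) p∼w

    u-edge : ∀ i j → i ∼[ T ] j → u i ∼[ G ] u j
    u-edge i j i∼j with view i | view j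
    ... | ‵fromℕ      | ‵fromℕ      = ⊥-elim (∼-irrefl T i∼j)
    ... | ‵fromℕ      | ‵inject₁ j′ = u-newEdge j′ i∼j
    ... | ‵inject₁ i′ | ‵fromℕ      = trans (sym G _ _) (u-newEdge i′ (trans (sym T _ _) i∼j))
    ... | ‵inject₁ i′ | ‵inject₁ j′ =
      subst₂ _∼[ G ]_ (≡-sym (u-old i′)) (≡-sym (u-old j′)) (v-edge i′ j′ i∼j)

    col-new : col c (u last) (u (inject₁ p)) ≡ col c (v p) w
    col-new = trans (cong₂ (col c) u-last (u-old p)) (col-sym c w (v p))

    col-old : ∀ i j → col c (u (inject₁ i)) (u (inject₁ j)) ≡ col c (v i) (v j)
    col-old i j = cong₂ (col c) (u-old i) (u-old j)

    u-rainbow : ∀ i j i′ j′ → i ∼[ T ] j → i′ ∼[ T ] j′ → toℕ j < toℕ i → toℕ j′ < toℕ i′ →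
                col c (u i) (u j) ≡ col c (u i′) (u j′) → (i ≡ i′) × (j ≡ j′)
    u-rainbow i j i′ j′ i∼j i′∼j′ j<i j′<i′ same with downEdge i∼j j<i | downEdge i′∼j′ j′<i′
    ... | new | new = refl , refl
    ... | new | old {i₁} {j₁} e lt =
      ⊥-elim (newColour i₁ j₁ e lt (trans (≡-sym col-new) (trans same (col-old i₁ j₁))))
    ... | old {i₁} {j₁} e lt | new =
      ⊥-elim (newColour i₁ j₁ e lt (trans (≡-sym col-new) (trans (≡-sym same) (col-old i₁ j₁))))
    ... | old {i₁} {j₁} e lt | old {i₂} {j₂} e′ lt′
      with refl , refl ← v-rainbow i₁ j₁ i₂ j₂ e e′ lt lt′
                            (trans (≡-sym (col-old i₁ j₁)) (trans same (col-old i₂ j₂))) = refl , refl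

    u-root-adj : ∀ i → adj G (u i) v₀ ≡ adj T i zero
    u-root-adj i with view i
    ... | ‵fromℕ      = trans (cong (λ x → adj G x v₀) u-last) w-root-adj
    ... | ‵inject₁ i′ = trans (cong (λ x → adj G x v₀) (u-old i′)) (v-root-adj i′)

    extend : RainbowEmbedding T G c v₀
    extend = record
      { v = u ; v-root = v-root ; v-injective = u-injective ; v-edge = u-edge
      ; v-rainbow = u-rainbow ; v-root-adj = u-root-adj }

  used : List (Fin n → Bool)
  used = tabulate (is ∘ v)

  oldColour : Fin k → ℕ
  oldColour m = col c (v (suc m)) (v (parent {T = deleteLast T} lo′ m))

  oldColours : List (Fin n → Bool)
  oldColours = tabulate (hasColour c (v p) ∘ oldColour)

  length-constraints : ∀ Ps → length (used ++ oldColours ++ Ps) ≡ suc k + (k + length Ps)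
  length-constraints Ps = begin
    length (used ++ oldColours ++ Ps)              ≡⟨ length-++ used ⟩
    length used + length (oldColours ++ Ps)        ≡⟨ cong (length used +_) (length-++ oldColours) ⟩
    length used + (length oldColours + length Ps)  ≡⟨ cong₂ (λ a b → a + (b + length Ps))
                                                            (length-tabulate (is ∘ v))
                                                            (length-tabulate (hasColour c (v p) ∘ oldColour)) ⟩
    suc k + (k + length Ps)                        ∎
    where open ≡-Reasoning

  closedNeighbour-admissible : ∀ {w} → w ∈ v p ∷ neighbours G (v p) →
                               Avoids w used → Avoids w oldColours → Admissible w
  closedNeighbour-admissible {w} w∈ avoidsUsed avoidsOldColours =
    record { p∼w = p∼w ; fresh = fresh ; newColour = newColour }
    where
    fresh : ∀ i → w ≢ v i
    fresh i w≡vi = All.tabulate⁻ {f = is ∘ v} avoidsUsed i (fromWitness w≡vi)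

    p∼w : v p ∼[ G ] w
    p∼w = ∈-closedNeighbourhood⁻ G w∈ (fresh p)

    newColour : ∀ i j → i ∼[ deleteLast T ] j → toℕ j < toℕ i → col c (v p) w ≢ col c (v i) (v j)
    newColour i j i∼j j<i same with downEdge⇒parent {T = deleteLast T} lo′ i∼j j<i
    ... | m , refl , refl =
      All.tabulate⁻ {f = hasColour c (v p) ∘ oldColour} avoidsOldColours m (from T-∧ (from T-≡ p∼w , fromWitness same))

  commonWithRoot : List (Fin n → Bool)
  commonWithRoot = map is (commonNeighbours G v₀ (v p))

  commonWithRoot-atMostOne : All AtMostOne commonWithRoot
  commonWithRoot-atMostOne = All.map⁺ (All.tabulate (λ {y} _ → is-atMostOne y))

  rootAdj-parentRoot : p ≡ zero → ∀ {w} → Admissible w → adj G w v₀ ≡ adj T last zero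
  rootAdj-parentRoot p≡0 {w} admissible =
    trans (sym G w v₀) (trans (subst (_∼[ G ] w) (trans (cong v p≡0) v-root) (Admissible.p∼w admissible))
                              (≡-sym (subst (λ j → last ∼[ T ] inject₁ j) p≡0 last∼p)))

  rootAdj-parentNotRoot : p ≢ zero → ∀ {w} → Admissible w → Avoids w commonWithRoot →
                          adj G w v₀ ≡ adj T last zero
  rootAdj-parentNotRoot p≢0 {w} admissible avoids = trans (sym G w v₀) (trans (¬-not v₀≁w) (≡-sym (¬-not last≁0)))
    where
    v₀≁w : ¬ v₀ ∼[ G ] w
    v₀≁w v₀∼w = All.lookup (All.map⁻ avoids) (∈-commonNeighbours⁺ G v₀∼w (Admissible.p∼w admissible))
                  (fromWitness {a? = w ≟ w} refl)

    last≁0 : ¬ last ∼[ T ] zero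
    last≁0 last∼0 = p≢0 (≡-sym (p-unique zero last∼0))

  extendWith : ∀ {Ps} → ∃[ w ] Admissible w × Avoids w Ps →
               (∀ {w} → Admissible w → Avoids w Ps → adj G w v₀ ≡ adj T last zero) →
               RainbowEmbedding T G c v₀
  extendWith (_ , admissible , avoids) rootAdj = extend admissible (rootAdj admissible avoids)

  module _ {r} (noK2r : K2r-free G r) (minDeg : minDegree> G (2 * suc k + r ∸ 3)) where

    -- Candidates are v p and its neighbours. Counting v p, which `used` excludes anyway, gives
    -- the unit of slack the degree bound needs: (k + 1) + k + |Ps| ≤ 2k + r < degree + 1.
    admissible-avoiding : (Ps : List (Fin n → Bool)) → All AtMostOne Ps → length Ps < r →
                          ∃[ w ] Admissible w × Avoids w Ps
    admissible-avoiding Ps Ps-atMostOne |Ps|<r =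
      choose (pigeonhole-avoid (closedNeighbourhood-unique G (v p)) (used ++ oldColours ++ Ps) atMostOne count)
      where
      atMostOne : All AtMostOne (used ++ oldColours ++ Ps)
      atMostOne = All.++⁺ (All.tabulate⁺ (is-atMostOne ∘ v))
                          (All.++⁺ (All.tabulate⁺ (hasColour-atMostOne c (v p) ∘ oldColour)) Ps-atMostOne)

      count : length (used ++ oldColours ++ Ps) < suc (degree G (v p))
      count = subst (_< suc (degree G (v p))) (≡-sym (length-constraints Ps))
                    (constraints<candidates {k = k} |Ps|<r (minDeg (v p)))

      choose : ∃[ w ] w ∈ v p ∷ neighbours G (v p) × Avoids w (used ++ oldColours ++ Ps) →
               ∃[ w ] Admissible w × Avoids w Ps
      choose (w , w∈ , avoids) =
        w , closedNeighbour-admissible w∈ (All.++⁻ˡ used avoids) (All.++⁻ˡ oldColours avoidsRest) ,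
        All.++⁻ʳ oldColours avoidsRest
        where
        avoidsRest : Avoids w (oldColours ++ Ps)
        avoidsRest = All.++⁻ʳ used avoids

    length-commonWithRoot< : p ≢ zero → length commonWithRoot < r
    length-commonWithRoot< p≢0 =
      subst (_< r) (≡-sym (length-map is (commonNeighbours G v₀ (v p))))
        (length-commonNeighbours< G noK2r λ v₀≡vp → p≢0 (≡-sym (v-injective (trans v-root v₀≡vp))))

    extension : 0 < r → RainbowEmbedding T G c v₀
    extension r>0 with p ≟ zero
    ... | yes p≡0 =
      extendWith (admissible-avoiding [] [] r>0) (λ admissible _ → rootAdj-parentRoot p≡0 admissible)
    ... | no p≢0 =
      extendWith (admissible-avoiding commonWithRoot commonWithRoot-atMostOne (length-commonWithRoot< p≢0))
                 (rootAdj-parentNotRoot p≢0)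

rainbowEmbedding : ∀ {r} k {n} → 0 < r →
  (T : Graph (suc k)) → IsLeafOrdering T →
  (G : Graph n) → K2r-free G r → minDegree> G (2 * k + r ∸ 3) →
  (c : ProperEdgeColouring G) (v₀ : Fin n) → RainbowEmbedding T G c v₀
rainbowEmbedding zero _ T _ G _ _ c v₀ = trivialEmbedding T c v₀
rainbowEmbedding {r} (suc k) r>0 T lo G noK2r minDeg c v₀ = Extension.extension lo E noK2r minDeg r>0
  where
  minDeg′ : minDegree> G (2 * k + r ∸ 3)
  minDeg′ u = ≤-<-trans (∸-monoˡ-≤ 3 (+-monoˡ-≤ r (*-monoʳ-≤ 2 (n≤1+n k)))) (minDeg u)

  E : RainbowEmbedding (deleteLast T) G c v₀
  E = rainbowEmbedding k r>0 (deleteLast T) (deleteLast-isLeafOrdering {T = T} lo) G noK2r minDeg′ c v₀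

lemma4p4 : (r k n : ℕ) → 3 ≤ r →
    (T : Graph (suc k)) → IsLeafOrdering T →
    (G : Graph n) → K2r-free G r → minDegree> G (2 * k + r ∸ 3) →
    (c : ProperEdgeColouring G) →
    (v₀ : Fin n) →
    Σ (Fin (suc k) → Fin n) λ v →
      (v Fin.zero ≡ v₀) ×
      Injective _≡_ _≡_ v ×
      (∀ i j → i ∼[ T ] j → v i ∼[ G ] v j) ×
      (∀ i j i' j' → i ∼[ T ] j → i' ∼[ T ] j' → toℕ j < toℕ i → toℕ j' < toℕ i' →
        col c (v i) (v j) ≡ col c (v i') (v j') → (i ≡ i') × (j ≡ j')) ×
      (∀ i → adj G (v i) v₀ ≡ adj T i Fin.zero)
lemma4p4 r k n 3≤r T lo G noK2r minDeg c v₀ = v , v-root , v-injective , v-edge , v-rainbow , v-root-adj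
  where open RainbowEmbedding (rainbowEmbedding k (≤-trans (s≤s z≤n) 3≤r) T lo G noK2r minDeg c v₀)
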